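{- Let $a_1,\dots,a_k$ and $b_1,\dots,b_k$ be positive integers such that $F(q)=\prod_{i=1}^k\frac{[a_i]_q}{[b_i]_q}$ is a polynomial in $q$, and let $X$ be a random variable with distribution $F$, i.e. $\Pr(X=j)=[q^j]F(q)/F(1)$. Then for every $r\ge1$ the $r$th cumulant of $X$ is \[\kappa_r(X)=\frac{B_r}{r}\sum_{i=1}^k\left(a_i^r-b_i^r\right),\] where $B_r$ is the $r$th Bernoulli number. In particular $\kappa_r(X)=0$ for odd $r>1$.
   Context: $[n]_q=1+q+\cdots+q^{n-1}$. The Bernoulli numbers are defined by $\sum_{r\ge0}B_r\frac{t^r}{r!}=\frac{t}{1-e^{ -t}}$ (so $B_1=1/2$). The cumulants $\kappa_r(X)$ are defined by $\ln\mathbb{E}(e^{tX})=\sum_{r\ge0}\kappa_r(X)\frac{t^r}{r!}$. -}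

module Defs where

open import Data.Nat as ℕ using (ℕ; zero; suc)
open import Data.Nat.Combinatorics using (_C_)
open import Data.Integer using (+_)
open import Data.Rational using (ℚ; 0ℚ; 1ℚ; _+_; _*_; _-_; _÷_; _/_; ≢-nonZero)
open import Data.Rational.Properties using (_≟_)
open import Data.Fin using (Fin) renaming (zero to fzero; suc to fsuc)
open import Data.List using (List; []; _∷_; _++_; replicate; length)
open import Relation.Nullary using (yes; no)

ℕ→ℚ : ℕ → ℚ
ℕ→ℚ n = + n / 1

_^ℚ_ : ℚ → ℕ → ℚ
x ^ℚ zero = 1ℚ
x ^ℚ suc n = x * (x ^ℚ n)

-- total division (junk value 0 when dividing by 0; never used under the
-- hypotheses of the theorem since F(1) = ∏ aᵢ / ∏ bᵢ > 0)
_÷₀_ : ℚ → ℚ → ℚ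
x ÷₀ y with y ≟ 0ℚ
... | yes _ = 0ℚ
... | no y≢0 = _÷_ x y {{≢-nonZero y≢0}}

Σ< : ℕ → (ℕ → ℚ) → ℚ
Σ< zero f = 0ℚ
Σ< (suc n) f = Σ< n f + f n

-- Polynomials in q with rational coefficients, as coefficient lists
-- (constant term first).

Poly : Set
Poly = List ℚ

coeff : Poly → ℕ → ℚ
coeff [] j = 0ℚ
coeff (c ∷ cs) zero = c
coeff (c ∷ cs) (suc j) = coeff cs j

scale : ℚ → Poly → Poly
scale x [] = []
scale x (c ∷ cs) = x * c ∷ scale x cs

_⊕_ : Poly → Poly → Poly
[] ⊕ q = q
(p ∷ ps) ⊕ [] = p ∷ ps
(p ∷ ps) ⊕ (q ∷ qs) = (p + q) ∷ (ps ⊕ qs)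

_⊛_ : Poly → Poly → Poly
[] ⊛ q = []
(p ∷ ps) ⊛ q = scale p q ⊕ (0ℚ ∷ (ps ⊛ q))

onePoly : Poly
onePoly = 1ℚ ∷ []

-- q-integer [n]_q = 1 + q + ... + q^{n-1}
qint : ℕ → Poly
qint n = replicate n 1ℚ

∏P : (k : ℕ) → (Fin k → Poly) → Poly
∏P zero P = onePoly
∏P (suc k) P = P fzero ⊛ ∏P k (λ i → P (fsuc i))

-- F(q) = ∏ [aᵢ]_q / ∏ [bᵢ]_q is the polynomial c (as an identity of
-- polynomials: c · ∏[bᵢ]_q = ∏[aᵢ]_q, compared coefficientwise)
IsQuotient : (k : ℕ) → (Fin k → ℕ) → (Fin k → ℕ) → Poly → Set
IsQuotient k a b c =
  ∀ j → coeff (c ⊛ ∏P k (λ i → qint (b i))) j ≡ coeff (∏P k (λ i → qint (a i))) j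
  where open import Relation.Binary.PropositionalEquality using (_≡_)

evalAt1 : Poly → ℚ
evalAt1 [] = 0ℚ
evalAt1 (c ∷ cs) = c + evalAt1 cs

prob : Poly → ℕ → ℚ
prob c j = coeff c j ÷₀ evalAt1 c

moment : Poly → ℕ → ℚ
moment c r = Σ< (length c) (λ j → (ℕ→ℚ j ^ℚ r) * prob c j)

-- Cumulants: the coefficients κ_r of the formal power series
-- ln E(e^{tX}) = ln M(t),  M(t) = Σ_r m_r t^r / r!  (m_0 = 1).
-- Since K = ln M is the unique series with K(0) = 0 and M' = M K',
-- κ_0 = 0 and, for n ≥ 1,
--   κ_n = m_n − Σ_{j=1}^{n-1} C(n-1, j-1) κ_j m_{n-j}.

nth : List ℚ → ℕ → ℚ
nth = coeff

cumulantsUpTo : (ℕ → ℚ) → ℕ → List ℚ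
cumulantsUpTo m zero = 0ℚ ∷ []
cumulantsUpTo m (suc n) =
  let ks = cumulantsUpTo m n
      N  = suc n
  in ks ++ ((m N - Σ< N (λ j → ℕ→ℚ (n C (j ℕ.∸ 1)) * nth ks j * m (N ℕ.∸ j)
                             -- the j = 0 term has κ_0 = 0
                             )) ∷ [])

cumulantFromMoments : (ℕ → ℚ) → ℕ → ℚ
cumulantFromMoments m r = nth (cumulantsUpTo m r) r

cumulant : Poly → ℕ → ℚ
cumulant c = cumulantFromMoments (moment c)

-- Bernoulli numbers: Σ_r B_r t^r / r! = t / (1 − e^{−t})   (B_1 = 1/2).
-- Multiplying by (1 − e^{−t})/t = Σ_n (−1)^n t^n/(n+1)! and comparing
-- coefficients of t^r/r!:  Σ_{j=0}^{r} C(r,j) (−1)^{r−j} B_j / (r−j+1) = [r = 0].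

sgn : ℕ → ℚ
sgn zero = 1ℚ
sgn (suc n) = 0ℚ - sgn n

bernoulliUpTo : ℕ → List ℚ
bernoulliUpTo zero = 1ℚ ∷ []
bernoulliUpTo (suc n) =
  let bs = bernoulliUpTo n
      r  = suc n
  in bs ++ ((0ℚ - Σ< r (λ j → ℕ→ℚ (r C j) * sgn (r ℕ.∸ j) * nth bs j
                               * (1ℚ ÷₀ ℕ→ℚ (suc (r ℕ.∸ j))))) ∷ [])

bernoulli : ℕ → ℚ
bernoulli r = nth (bernoulliUpTo r) r

ΣFin : (k : ℕ) → (Fin k → ℚ) → ℚ
ΣFin zero f = 0ℚ
ΣFin (suc k) f = f fzero + ΣFin k (λ i → f (fsuc i))

-- We work in the ring ℚ[[t]] of formal power series, represented by
-- coefficient functions ℕ → ℚ, and say that κ is a logarithm of f when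
-- f' = κ' f.  Substituting q = e^t turns the polynomial F(q) into the
-- series F(e^t) = F(1) · E(e^{tX}), and the recursive definition of the
-- cumulants says precisely that K(t) = Σ κ_n tⁿ/n! is a logarithm of
-- E(e^{tX}), hence of F(e^t).  On the other hand, with φ(t) = (e^t − 1)/t,
-- the definition of the Bernoulli numbers gives that
-- β(t) = Σ_{n≥1} (B_n/n) tⁿ/n! is a logarithm of φ, and the identity
-- φ(t) · [a]_{e^t} = a · φ(at) shows that β(at) − β(t) is a logarithm of
-- [a]_{e^t}.  Logarithms add over products and subtract over quotients,
-- so Σᵢ β(aᵢt) − β(bᵢt) is a logarithm of F(e^t); since logarithms of a
-- series with nonzero constant term are unique up to the constant term,
-- comparing coefficients of tʳ/r! yields κ_r = (B_r/r) Σᵢ (aᵢʳ − bᵢʳ).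

module Submission where

open import Defs
open import Data.Nat using (ℕ; _<_; _≤_; _∸_)
open import Data.Fin using (Fin)
open import Data.Rational using (ℚ; 0ℚ; _-_; _*_) renaming (_≤_ to _≤ℚ_)
open import Relation.Binary.PropositionalEquality using (_≡_)

open import Data.Nat as ℕ using (zero; suc; z≤n; s≤s; _!)
open import Data.Nat.Combinatorics using (_C_)
import Data.Nat.Properties as ℕP
open import Data.Nat.Combinatorics.Specification using (nCk≡n!/k![n-k]!; [n∸k]!k!∣n!)
open import Data.Nat.DivMod using (m/n*n≡m)
open import Data.Nat.Divisibility using (_∣_)
open import Data.Nat.Coprimality using (1-coprimeTo) renaming (sym to coprime-sym)
open import Data.Integer as ℤ using () renaming (+_ to pos)
import Data.Integer.Properties as ℤP
open import Data.Rational using (1ℚ; _+_; mkℚ; 1/_; ≢-nonZero)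
open import Data.Rational.Properties as ℚP using (toℚᵘ-injective; toℚᵘ-homo-+; normalize-coprime)
import Data.Rational.Unnormalised as ℚᵘ
import Data.Rational.Unnormalised.Properties as ℚᵘP
open import Data.Rational.Solver using (module +-*-Solver)
open +-*-Solver
open import Data.Fin using () renaming (zero to fzero; suc to fsuc)
open import Data.List using (List; []; _∷_; _++_; length)
open import Data.Product using (Σ-syntax; _,_; proj₁; proj₂)
open import Data.Sum using (inj₁; inj₂)
open import Data.Empty using (⊥-elim)
open import Relation.Nullary using (yes; no)
open import Function using (_∘_)
open import Relation.Binary.PropositionalEquality
  using (refl; sym; trans; cong; cong₂; subst; _≢_; _≗_; module ≡-Reasoning)

ι : ℕ → ℚ
ι = ℕ→ℚ

private
  ι-coprime : ∀ n → ι n ≡ mkℚ (pos n) 0 (coprime-sym (1-coprimeTo n))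
  ι-coprime n = normalize-coprime (coprime-sym (1-coprimeTo n))

ι-suc : ∀ n → ι (suc n) ≡ 1ℚ + ι n
ι-suc n rewrite ι-coprime n | ι-coprime (suc n) =
  toℚᵘ-injective (ℚᵘP.≃-sym (ℚᵘP.≃-trans
    (toℚᵘ-homo-+ 1ℚ (mkℚ (pos n) 0 (coprime-sym (1-coprimeTo n)))) (ℚᵘ.*≡* cross)))
  where
  cross : (pos 1 ℤ.* pos 1 ℤ.+ pos n ℤ.* pos 1) ℤ.* pos 1 ≡ pos (suc n) ℤ.* pos 1
  cross rewrite ℤP.*-identityʳ (pos n) = refl

ι-+ : ∀ m n → ι (m ℕ.+ n) ≡ ι m + ι n
ι-+ zero n = sym (ℚP.+-identityˡ (ι n))
ι-+ (suc m) n = begin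
  ι (suc (m ℕ.+ n)) ≡⟨ ι-suc (m ℕ.+ n) ⟩
  1ℚ + ι (m ℕ.+ n)  ≡⟨ cong (1ℚ +_) (ι-+ m n) ⟩
  1ℚ + (ι m + ι n)  ≡⟨ sym (ℚP.+-assoc 1ℚ (ι m) (ι n)) ⟩
  (1ℚ + ι m) + ι n  ≡⟨ cong (_+ ι n) (sym (ι-suc m)) ⟩
  ι (suc m) + ι n   ∎
  where open ≡-Reasoning

ι-* : ∀ m n → ι (m ℕ.* n) ≡ ι m * ι n
ι-* zero n = sym (ℚP.*-zeroˡ (ι n))
ι-* (suc m) n = begin
  ι (n ℕ.+ m ℕ.* n)  ≡⟨ ι-+ n (m ℕ.* n) ⟩
  ι n + ι (m ℕ.* n)  ≡⟨ cong (ι n +_) (ι-* m n) ⟩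
  ι n + ι m * ι n    ≡⟨ solve 2 (λ a b → b :+ a :* b := (con 1ℚ :+ a) :* b) refl (ι m) (ι n) ⟩
  (1ℚ + ι m) * ι n   ≡⟨ cong (_* ι n) (sym (ι-suc m)) ⟩
  ι (suc m) * ι n    ∎
  where open ≡-Reasoning

recip : ℕ → ℚ
recip n = 1/ (mkℚ (pos (suc n)) 0 (coprime-sym (1-coprimeTo (suc n))))

ι-recip : ∀ n → ι (suc n) * recip n ≡ 1ℚ
ι-recip n rewrite ι-coprime (suc n) =
  ℚP.*-inverseʳ (mkℚ (pos (suc n)) 0 (coprime-sym (1-coprimeTo (suc n))))

*-cancelˡ-≢0 : ∀ {x a b} → x ≢ 0ℚ → x * a ≡ x * b → a ≡ b
*-cancelˡ-≢0 {x} {a} {b} x≢0 eq = begin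
  a                ≡⟨ sym (ℚP.*-identityˡ a) ⟩
  1ℚ * a           ≡⟨ cong (_* a) (sym (ℚP.*-inverseˡ x)) ⟩
  (1/ x) * x * a   ≡⟨ ℚP.*-assoc (1/ x) x a ⟩
  (1/ x) * (x * a) ≡⟨ cong ((1/ x) *_) eq ⟩
  (1/ x) * (x * b) ≡⟨ sym (ℚP.*-assoc (1/ x) x b) ⟩
  (1/ x) * x * b   ≡⟨ cong (_* b) (ℚP.*-inverseˡ x) ⟩
  1ℚ * b           ≡⟨ ℚP.*-identityˡ b ⟩
  b                ∎
  where
  open ≡-Reasoning
  instance _ = ≢-nonZero x≢0

*-≢0 : ∀ {x y} → x ≢ 0ℚ → y ≢ 0ℚ → x * y ≢ 0ℚ
*-≢0 {x} x≢0 y≢0 xy≡0 = y≢0 (*-cancelˡ-≢0 x≢0 (trans xy≡0 (sym (ℚP.*-zeroʳ x))))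

invertible⇒≢0 : ∀ {y w} → y * w ≡ 1ℚ → y ≢ 0ℚ
invertible⇒≢0 {y} {w} yw≡1 y≡0 =
  ℚP.1≢0 (trans (sym yw≡1) (trans (cong (_* w) y≡0) (ℚP.*-zeroˡ w)))

ι-suc≢0 : ∀ n → ι (suc n) ≢ 0ℚ
ι-suc≢0 n = invertible⇒≢0 (ι-recip n)

ι≢0 : ∀ {n} → 0 < n → ι n ≢ 0ℚ
ι≢0 {suc n} _ = ι-suc≢0 n

÷₀-by-inverse : ∀ {x y w} → y * w ≡ 1ℚ → x ÷₀ y ≡ x * w
÷₀-by-inverse {x} {y} {w} yw≡1 with y ℚP.≟ 0ℚ
... | yes y≡0 = ⊥-elim (invertible⇒≢0 yw≡1 y≡0)
... | no y≢0 = cong (x *_) (*-cancelˡ-≢0 y≢0 (trans (ℚP.*-inverseʳ y) (sym yw≡1)))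
  where instance _ = ≢-nonZero y≢0

÷₀-ι-suc : ∀ x n → x ÷₀ ι (suc n) ≡ x * recip n
÷₀-ι-suc x n = ÷₀-by-inverse {x = x} {y = ι (suc n)} (ι-recip n)

invFact : ℕ → ℚ
invFact zero = 1ℚ
invFact (suc n) = invFact n * recip n

-- (n+1) · 1/(n+1)! = 1/n!, the identity that makes ∂ act on tⁿ/n! as a shift.
ι-suc*invFact : ∀ n → ι (suc n) * invFact (suc n) ≡ invFact n
ι-suc*invFact n = begin
  ι (suc n) * (invFact n * recip n)
    ≡⟨ solve 3 (λ a b c → a :* (b :* c) := b :* (a :* c)) refl (ι (suc n)) (invFact n) (recip n) ⟩
  invFact n * (ι (suc n) * recip n) ≡⟨ cong (invFact n *_) (ι-recip n) ⟩
  invFact n * 1ℚ                    ≡⟨ ℚP.*-identityʳ (invFact n) ⟩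
  invFact n                         ∎
  where open ≡-Reasoning

ι-!*invFact : ∀ n → ι (n !) * invFact n ≡ 1ℚ
ι-!*invFact zero = refl
ι-!*invFact (suc n) = begin
  ι (suc n ℕ.* n !) * (invFact n * recip n)
    ≡⟨ cong (_* (invFact n * recip n)) (ι-* (suc n) (n !)) ⟩
  ι (suc n) * ι (n !) * (invFact n * recip n)
    ≡⟨ solve 4 (λ a b c d → a :* b :* (c :* d) := (a :* d) :* (b :* c)) refl
         (ι (suc n)) (ι (n !)) (invFact n) (recip n) ⟩
  (ι (suc n) * recip n) * (ι (n !) * invFact n)
    ≡⟨ cong₂ _*_ (ι-recip n) (ι-!*invFact n) ⟩
  1ℚ ∎
  where open ≡-Reasoning

invFact≢0 : ∀ n → invFact n ≢ 0ℚ
invFact≢0 n = invertible⇒≢0 (trans (ℚP.*-comm (invFact n) (ι (n !))) (ι-!*invFact n))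

binomial*invFact : ∀ n i → i ≤ n → ι (n C i) * invFact n ≡ invFact i * invFact (n ∸ i)
binomial*invFact n i i≤n = *-cancelˡ-≢0 {x = ι (n !)} (invertible⇒≢0 {w = invFact n} (ι-!*invFact n)) (begin
  ι (n !) * (ι (n C i) * invFact n)
    ≡⟨ solve 3 (λ f c g → f :* (c :* g) := c :* (f :* g)) refl (ι (n !)) (ι (n C i)) (invFact n) ⟩
  ι (n C i) * (ι (n !) * invFact n)     ≡⟨ cong (ι (n C i) *_) (ι-!*invFact n) ⟩
  ι (n C i) * 1ℚ
    ≡⟨ cong (ι (n C i) *_) (sym (cong₂ _*_ (ι-!*invFact i) (ι-!*invFact (n ∸ i)))) ⟩
  ι (n C i) * ((ι (i !) * invFact i) * (ι ((n ∸ i) !) * invFact (n ∸ i)))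
    ≡⟨ solve 5 (λ c a x b y → c :* ((a :* x) :* (b :* y)) := (c :* (a :* b)) :* (x :* y)) refl
         (ι (n C i)) (ι (i !)) (invFact i) (ι ((n ∸ i) !)) (invFact (n ∸ i)) ⟩
  (ι (n C i) * (ι (i !) * ι ((n ∸ i) !))) * (invFact i * invFact (n ∸ i))
    ≡⟨ cong (_* (invFact i * invFact (n ∸ i))) (sym (ι-C*!*! )) ⟩
  ι (n !) * (invFact i * invFact (n ∸ i)) ∎)
  where
  open ≡-Reasoning
  C*!*! : (n C i) ℕ.* (i ! ℕ.* (n ∸ i) !) ≡ n !
  C*!*! = trans (cong (ℕ._* (i ! ℕ.* (n ∸ i) !)) (nCk≡n!/k![n-k]! i≤n))
    (m/n*n≡m {{i ℕP.!* (n ∸ i) !≢0}}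
      (subst (_∣ n !) (ℕP.*-comm ((n ∸ i) !) (i !)) ([n∸k]!k!∣n! i≤n)))
  ι-C*!*! : ι (n !) ≡ ι (n C i) * (ι (i !) * ι ((n ∸ i) !))
  ι-C*!*! = trans (cong ι (sym C*!*!))
    (trans (ι-* (n C i) (i ! ℕ.* (n ∸ i) !)) (cong (ι (n C i) *_) (ι-* (i !) ((n ∸ i) !))))

-- Formal power series ℚ[[t]], as coefficient functions

-- A series f stands for Σ f(n) tⁿ.
Series : Set
Series = ℕ → ℚ

0ₛ : Series
0ₛ _ = 0ℚ

1ₛ : Series
1ₛ zero = 1ℚ
1ₛ (suc n) = 0ℚ

shift : Series → Series
shift f n = f (suc n)

timesT : Series → Series
timesT f zero = 0ℚ
timesT f (suc n) = f n

infixl 6 _⊞_ _⊟_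
infixl 7 _·_ _⋆_

_⊞_ : Series → Series → Series
(f ⊞ g) n = f n + g n

_⊟_ : Series → Series → Series
(f ⊟ g) n = f n - g n

_·_ : ℚ → Series → Series
(c · f) n = c * f n

-- Cauchy product, by peeling off the constant term of the left factor:
-- f ⋆ g = f(0) g + t (shift f ⋆ g).
_⋆_ : Series → Series → Series
(f ⋆ g) zero = f 0 * g 0
(f ⋆ g) (suc n) = f 0 * g (suc n) + (shift f ⋆ g) n

∂ : Series → Series
∂ f n = ι (suc n) * f (suc n)

-- The product is defined by recursion on the left
-- factor, so the left-handed laws are proved by induction on the degree
-- and the right-handed ones are derived from commutativity.
⋆-cong : ∀ {f f′ g g′} → f ≗ f′ → g ≗ g′ → f ⋆ g ≗ f′ ⋆ g′
⋆-cong f≗ g≗ zero = cong₂ _*_ (f≗ 0) (g≗ 0)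
⋆-cong f≗ g≗ (suc n) = cong₂ _+_ (cong₂ _*_ (f≗ 0) (g≗ (suc n))) (⋆-cong (f≗ ∘ suc) g≗ n)

⋆-congˡ : ∀ {f f′} g → f ≗ f′ → f ⋆ g ≗ f′ ⋆ g
⋆-congˡ g f≗ = ⋆-cong f≗ (λ _ → refl)

⋆-congʳ : ∀ f {g g′} → g ≗ g′ → f ⋆ g ≗ f ⋆ g′
⋆-congʳ f g≗ = ⋆-cong (λ _ → refl) g≗

⋆-zeroˡ : ∀ g → 0ₛ ⋆ g ≗ 0ₛ
⋆-zeroˡ g zero = ℚP.*-zeroˡ (g 0)
⋆-zeroˡ g (suc n) = cong₂ _+_ (ℚP.*-zeroˡ (g (suc n))) (⋆-zeroˡ g n)

⋆-zeroʳ : ∀ f → f ⋆ 0ₛ ≗ 0ₛ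
⋆-zeroʳ f zero = ℚP.*-zeroʳ (f 0)
⋆-zeroʳ f (suc n) = cong₂ _+_ (ℚP.*-zeroʳ (f 0)) (⋆-zeroʳ (shift f) n)

⋆-identityˡ : ∀ g → 1ₛ ⋆ g ≗ g
⋆-identityˡ g zero = ℚP.*-identityˡ (g 0)
⋆-identityˡ g (suc n) =
  trans (cong₂ _+_ (ℚP.*-identityˡ (g (suc n))) (⋆-zeroˡ g n)) (ℚP.+-identityʳ (g (suc n)))

⋆-identityʳ : ∀ f → f ⋆ 1ₛ ≗ f
⋆-identityʳ f zero = ℚP.*-identityʳ (f 0)
⋆-identityʳ f (suc n) =
  trans (cong₂ _+_ (ℚP.*-zeroʳ (f 0)) (⋆-identityʳ (shift f) n)) (ℚP.+-identityˡ (f (suc n)))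

⋆-timesT : ∀ f g n → (timesT f ⋆ g) (suc n) ≡ (f ⋆ g) n
⋆-timesT f g n =
  trans (cong (_+ (f ⋆ g) n) (ℚP.*-zeroˡ (g (suc n)))) (ℚP.+-identityˡ ((f ⋆ g) n))

⋆-comm : ∀ f g → f ⋆ g ≗ g ⋆ f
⋆-comm f g zero = ℚP.*-comm (f 0) (g 0)
⋆-comm f g (suc zero) =
  solve 4 (λ a b c d → a :* b :+ c :* d := d :* c :+ b :* a) refl (f 0) (g 1) (f 1) (g 0)
⋆-comm f g (suc (suc n)) = begin
  f 0 * g (2 ℕ.+ n) + (shift f ⋆ g) (suc n)
    ≡⟨ cong (f 0 * g (2 ℕ.+ n) +_) (⋆-comm (shift f) g (suc n)) ⟩
  f 0 * g (2 ℕ.+ n) + (g 0 * f (2 ℕ.+ n) + (shift g ⋆ shift f) n)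
    ≡⟨ cong (λ z → f 0 * g (2 ℕ.+ n) + (g 0 * f (2 ℕ.+ n) + z)) (⋆-comm (shift g) (shift f) n) ⟩
  f 0 * g (2 ℕ.+ n) + (g 0 * f (2 ℕ.+ n) + (shift f ⋆ shift g) n)
    ≡⟨ solve 5 (λ a b c d e → a :* b :+ (c :* d :+ e) := c :* d :+ (a :* b :+ e)) refl
         (f 0) (g (2 ℕ.+ n)) (g 0) (f (2 ℕ.+ n)) ((shift f ⋆ shift g) n) ⟩
  g 0 * f (2 ℕ.+ n) + (f 0 * g (2 ℕ.+ n) + (shift f ⋆ shift g) n)
    ≡⟨ cong (g 0 * f (2 ℕ.+ n) +_) (⋆-comm f (shift g) (suc n)) ⟩
  g 0 * f (2 ℕ.+ n) + (shift g ⋆ f) (suc n) ∎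
  where open ≡-Reasoning

⋆-distribˡ-⊞ : ∀ f g h → f ⋆ (g ⊞ h) ≗ f ⋆ g ⊞ f ⋆ h
⋆-distribˡ-⊞ f g h zero = ℚP.*-distribˡ-+ (f 0) (g 0) (h 0)
⋆-distribˡ-⊞ f g h (suc n) = begin
  f 0 * (g (suc n) + h (suc n)) + (shift f ⋆ (g ⊞ h)) n
    ≡⟨ cong (f 0 * (g (suc n) + h (suc n)) +_) (⋆-distribˡ-⊞ (shift f) g h n) ⟩
  f 0 * (g (suc n) + h (suc n)) + ((shift f ⋆ g) n + (shift f ⋆ h) n)
    ≡⟨ solve 5 (λ a b c d e → a :* (b :+ c) :+ (d :+ e) := (a :* b :+ d) :+ (a :* c :+ e)) refl
         (f 0) (g (suc n)) (h (suc n)) ((shift f ⋆ g) n) ((shift f ⋆ h) n) ⟩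
  (f 0 * g (suc n) + (shift f ⋆ g) n) + (f 0 * h (suc n) + (shift f ⋆ h) n) ∎
  where open ≡-Reasoning

⋆-distribˡ-⊟ : ∀ f g h → f ⋆ (g ⊟ h) ≗ f ⋆ g ⊟ f ⋆ h
⋆-distribˡ-⊟ f g h zero = solve 3 (λ a b c → a :* (b :- c) := a :* b :- a :* c) refl (f 0) (g 0) (h 0)
⋆-distribˡ-⊟ f g h (suc n) = begin
  f 0 * (g (suc n) - h (suc n)) + (shift f ⋆ (g ⊟ h)) n
    ≡⟨ cong (f 0 * (g (suc n) - h (suc n)) +_) (⋆-distribˡ-⊟ (shift f) g h n) ⟩
  f 0 * (g (suc n) - h (suc n)) + ((shift f ⋆ g) n - (shift f ⋆ h) n)
    ≡⟨ solve 5 (λ a b c d e → a :* (b :- c) :+ (d :- e) := (a :* b :+ d) :- (a :* c :+ e)) refl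
         (f 0) (g (suc n)) (h (suc n)) ((shift f ⋆ g) n) ((shift f ⋆ h) n) ⟩
  (f 0 * g (suc n) + (shift f ⋆ g) n) - (f 0 * h (suc n) + (shift f ⋆ h) n) ∎
  where open ≡-Reasoning

⋆-scaleʳ : ∀ c f g → f ⋆ (c · g) ≗ c · (f ⋆ g)
⋆-scaleʳ c f g zero = solve 3 (λ a b d → b :* (a :* d) := a :* (b :* d)) refl c (f 0) (g 0)
⋆-scaleʳ c f g (suc n) = begin
  f 0 * (c * g (suc n)) + (shift f ⋆ (c · g)) n
    ≡⟨ cong (f 0 * (c * g (suc n)) +_) (⋆-scaleʳ c (shift f) g n) ⟩
  f 0 * (c * g (suc n)) + c * (shift f ⋆ g) n
    ≡⟨ solve 4 (λ a b d e → b :* (a :* d) :+ a :* e := a :* (b :* d :+ e)) refl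
         c (f 0) (g (suc n)) ((shift f ⋆ g) n) ⟩
  c * (f 0 * g (suc n) + (shift f ⋆ g) n) ∎
  where open ≡-Reasoning

⋆-distribʳ-⊞ : ∀ f g h → (f ⊞ g) ⋆ h ≗ f ⋆ h ⊞ g ⋆ h
⋆-distribʳ-⊞ f g h n = trans (⋆-comm (f ⊞ g) h n)
  (trans (⋆-distribˡ-⊞ h f g n) (cong₂ _+_ (⋆-comm h f n) (⋆-comm h g n)))

⋆-distribʳ-⊟ : ∀ f g h → (f ⊟ g) ⋆ h ≗ f ⋆ h ⊟ g ⋆ h
⋆-distribʳ-⊟ f g h n = trans (⋆-comm (f ⊟ g) h n)
  (trans (⋆-distribˡ-⊟ h f g n) (cong₂ _-_ (⋆-comm h f n) (⋆-comm h g n)))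

⋆-scaleˡ : ∀ c f g → (c · f) ⋆ g ≗ c · (f ⋆ g)
⋆-scaleˡ c f g n = trans (⋆-comm (c · f) g n)
  (trans (⋆-scaleʳ c g f n) (cong (c *_) (⋆-comm g f n)))

⋆-assoc : ∀ f g h → (f ⋆ g) ⋆ h ≗ f ⋆ (g ⋆ h)
⋆-assoc f g h zero = ℚP.*-assoc (f 0) (g 0) (h 0)
⋆-assoc f g h (suc n) = begin
  f 0 * g 0 * h (suc n) + (((f 0 · shift g) ⊞ (shift f ⋆ g)) ⋆ h) n
    ≡⟨ cong (f 0 * g 0 * h (suc n) +_) (⋆-distribʳ-⊞ (f 0 · shift g) (shift f ⋆ g) h n) ⟩
  f 0 * g 0 * h (suc n) + (((f 0 · shift g) ⋆ h) n + ((shift f ⋆ g) ⋆ h) n)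
    ≡⟨ cong₂ (λ x y → f 0 * g 0 * h (suc n) + (x + y))
         (⋆-scaleˡ (f 0) (shift g) h n) (⋆-assoc (shift f) g h n) ⟩
  f 0 * g 0 * h (suc n) + (f 0 * (shift g ⋆ h) n + (shift f ⋆ (g ⋆ h)) n)
    ≡⟨ solve 5 (λ a b c d e → a :* b :* c :+ (a :* d :+ e) := a :* (b :* c :+ d) :+ e) refl
         (f 0) (g 0) (h (suc n)) ((shift g ⋆ h) n) ((shift f ⋆ (g ⋆ h)) n) ⟩
  f 0 * (g 0 * h (suc n) + (shift g ⋆ h) n) + (shift f ⋆ (g ⋆ h)) n ∎
  where open ≡-Reasoning

∂-⊞ : ∀ f g → ∂ (f ⊞ g) ≗ ∂ f ⊞ ∂ g
∂-⊞ f g n = ℚP.*-distribˡ-+ (ι (suc n)) (f (suc n)) (g (suc n))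

∂-⊟ : ∀ f g → ∂ (f ⊟ g) ≗ ∂ f ⊟ ∂ g
∂-⊟ f g n =
  solve 3 (λ a b c → a :* (b :- c) := a :* b :- a :* c) refl (ι (suc n)) (f (suc n)) (g (suc n))

∂-scale : ∀ c f → ∂ (c · f) ≗ c · ∂ f
∂-scale c f n = solve 3 (λ a b d → a :* (b :* d) := b :* (a :* d)) refl (ι (suc n)) c (f (suc n))

shift-∂ : ∀ f → shift (∂ f) ≗ ∂ (shift f) ⊞ shift (shift f)
shift-∂ f n = begin
  ι (2 ℕ.+ n) * f (2 ℕ.+ n)              ≡⟨ cong (_* f (2 ℕ.+ n)) (ι-suc (suc n)) ⟩
  (1ℚ + ι (suc n)) * f (2 ℕ.+ n)
    ≡⟨ solve 2 (λ i x → (con 1ℚ :+ i) :* x := i :* x :+ x) refl (ι (suc n)) (f (2 ℕ.+ n)) ⟩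
  ι (suc n) * f (2 ℕ.+ n) + f (2 ℕ.+ n) ∎
  where open ≡-Reasoning

∂-leibniz : ∀ f g → ∂ (f ⋆ g) ≗ ∂ f ⋆ g ⊞ f ⋆ ∂ g
∂-leibniz f g zero =
  solve 5 (λ i f0 f1 g0 g1 → i :* (f0 :* g1 :+ f1 :* g0) := i :* f1 :* g0 :+ f0 :* (i :* g1)) refl
    (ι 1) (f 0) (f 1) (g 0) (g 1)
∂-leibniz f g (suc n) = begin
  ι (2 ℕ.+ n) * (f 0 * g (2 ℕ.+ n) + (f 1 * g (suc n) + Q))
    ≡⟨ cong (λ z → z * (f 0 * g (2 ℕ.+ n) + (f 1 * g (suc n) + Q))) (ι-suc (suc n)) ⟩
  (1ℚ + u) * (f 0 * g (2 ℕ.+ n) + (f 1 * g (suc n) + Q))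
    ≡⟨ solve 6 (λ u f0 f1 g1 g2 Q →
         (con 1ℚ :+ u) :* (f0 :* g2 :+ (f1 :* g1 :+ Q))
         := (u :* (f1 :* g1 :+ Q) :+ f1 :* g1 :+ Q) :+ f0 :* ((con 1ℚ :+ u) :* g2)) refl
         u (f 0) (f 1) (g (suc n)) (g (2 ℕ.+ n)) Q ⟩
  (∂ (shift f ⋆ g) n + f 1 * g (suc n) + Q) + f 0 * ((1ℚ + u) * g (2 ℕ.+ n))
    ≡⟨ cong₂ (λ x y → (x + f 1 * g (suc n) + Q) + f 0 * y)
         (∂-leibniz (shift f) g n) (cong (_* g (2 ℕ.+ n)) (sym (ι-suc (suc n)))) ⟩
  ((∂ (shift f) ⋆ g) n + (shift f ⋆ ∂ g) n + f 1 * g (suc n) + Q) + f 0 * ∂ g (suc n)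
    ≡⟨ solve 6 (λ A B F Q ff dg → (A :+ B :+ F :+ Q) :+ ff :* dg := (F :+ (A :+ Q)) :+ (ff :* dg :+ B)) refl
         ((∂ (shift f) ⋆ g) n) ((shift f ⋆ ∂ g) n) (f 1 * g (suc n)) Q (f 0) (∂ g (suc n)) ⟩
  (f 1 * g (suc n) + ((∂ (shift f) ⋆ g) n + Q)) + (f 0 * ∂ g (suc n) + (shift f ⋆ ∂ g) n)
    ≡⟨ cong (λ z → (z + ((∂ (shift f) ⋆ g) n + Q)) + (f 0 * ∂ g (suc n) + (shift f ⋆ ∂ g) n))
         (cong (_* g (suc n)) (sym (ℚP.*-identityˡ (f 1)))) ⟩
  (1ℚ * f 1 * g (suc n) + ((∂ (shift f) ⋆ g) n + Q)) + (f 0 * ∂ g (suc n) + (shift f ⋆ ∂ g) n)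
    ≡⟨ cong (λ z → (1ℚ * f 1 * g (suc n) + z) + (f 0 * ∂ g (suc n) + (shift f ⋆ ∂ g) n))
         (sym (trans (⋆-congˡ g (shift-∂ f) n) (⋆-distribʳ-⊞ (∂ (shift f)) (shift (shift f)) g n))) ⟩
  (1ℚ * f 1 * g (suc n) + (shift (∂ f) ⋆ g) n) + (f 0 * ∂ g (suc n) + (shift f ⋆ ∂ g) n) ∎
  where
  open ≡-Reasoning
  u = ι (suc n)
  Q = (shift (shift f) ⋆ g) n

infixr 8 _^_
_^_ : ℚ → ℕ → ℚ
_^_ = _^ℚ_

exp : ℚ → Series
exp x n = (x ^ n) * invFact n

∂-exp : ∀ x → ∂ (exp x) ≗ x · exp x
∂-exp x n = begin
  ι (suc n) * (x * (x ^ n) * (invFact n * recip n))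
    ≡⟨ solve 4 (λ i a b c → i :* (a :* b :* c) := a :* b :* (i :* c)) refl
         (ι (suc n)) x (x ^ n) (invFact (suc n)) ⟩
  x * (x ^ n) * (ι (suc n) * invFact (suc n)) ≡⟨ cong (x * (x ^ n) *_) (ι-suc*invFact n) ⟩
  x * (x ^ n) * invFact n                     ≡⟨ ℚP.*-assoc x (x ^ n) (invFact n) ⟩
  x * ((x ^ n) * invFact n)                   ∎
  where open ≡-Reasoning

exp-unique : ∀ {f} c → ∂ f ≗ c · f → f ≗ f 0 · exp c
exp-unique {f} c ∂f zero = sym (ℚP.*-identityʳ (f 0))
exp-unique {f} c ∂f (suc n) = *-cancelˡ-≢0 (ι-suc≢0 n) (begin
  ι (suc n) * f (suc n)                ≡⟨ ∂f n ⟩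
  c * f n                              ≡⟨ cong (c *_) (exp-unique c ∂f n) ⟩
  c * (f 0 * exp c n)                  ≡⟨ solve 3 (λ a b d → a :* (b :* d) := b :* (a :* d)) refl c (f 0) (exp c n) ⟩
  f 0 * (c * exp c n)                  ≡⟨ cong (f 0 *_) (sym (∂-exp c n)) ⟩
  f 0 * ∂ (exp c) n                    ≡⟨ sym (∂-scale (f 0) (exp c) n) ⟩
  ι (suc n) * (f 0 * exp c (suc n))    ∎)
  where open ≡-Reasoning

-- e^{xt} e^{yt} = e^{(x+y)t}: both sides solve f' = (x+y) f, f(0) = 1.
exp-+ : ∀ x y → exp x ⋆ exp y ≗ exp (x + y)
exp-+ x y n = trans (exp-unique (x + y) ∂-product n) (ℚP.*-identityˡ _)
  where
  open ≡-Reasoning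
  ∂-product : ∂ (exp x ⋆ exp y) ≗ (x + y) · (exp x ⋆ exp y)
  ∂-product k = begin
    ∂ (exp x ⋆ exp y) k                          ≡⟨ ∂-leibniz (exp x) (exp y) k ⟩
    (∂ (exp x) ⋆ exp y) k + (exp x ⋆ ∂ (exp y)) k
      ≡⟨ cong₂ _+_ (⋆-congˡ (exp y) (∂-exp x) k) (⋆-congʳ (exp x) (∂-exp y) k) ⟩
    ((x · exp x) ⋆ exp y) k + (exp x ⋆ (y · exp y)) k
      ≡⟨ cong₂ _+_ (⋆-scaleˡ x (exp x) (exp y) k) (⋆-scaleʳ y (exp x) (exp y) k) ⟩
    x * (exp x ⋆ exp y) k + y * (exp x ⋆ exp y) k ≡⟨ sym (ℚP.*-distribʳ-+ _ x y) ⟩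
    (x + y) * (exp x ⋆ exp y) k                  ∎

exp-0 : exp 0ℚ ≗ 1ₛ
exp-0 zero = refl
exp-0 (suc n) =
  trans (cong (_* invFact (suc n)) (ℚP.*-zeroˡ (0ℚ ^ n))) (ℚP.*-zeroˡ (invFact (suc n)))

-- Logarithms of series

-- κ is a logarithm of f (up to its constant term) when f' = κ' f.
Log : Series → Series → Set
Log f κ = ∂ f ≗ ∂ κ ⋆ f

Log-congˡ : ∀ {f f′ κ} → f ≗ f′ → Log f κ → Log f′ κ
Log-congˡ {κ = κ} f≗ L n =
  trans (cong (ι (suc n) *_) (sym (f≗ (suc n)))) (trans (L n) (⋆-congʳ (∂ κ) f≗ n))

Log-1 : Log 1ₛ 0ₛ
Log-1 n = trans (ℚP.*-zeroʳ (ι (suc n)))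
  (sym (trans (⋆-congˡ 1ₛ (λ k → ℚP.*-zeroʳ (ι (suc k))) n) (⋆-zeroˡ 1ₛ n)))

Log-scale : ∀ {f κ} c → Log f κ → Log (c · f) κ
Log-scale {f} {κ} c L n = begin
  ∂ (c · f) n      ≡⟨ ∂-scale c f n ⟩
  c * ∂ f n        ≡⟨ cong (c *_) (L n) ⟩
  c * (∂ κ ⋆ f) n  ≡⟨ sym (⋆-scaleʳ c (∂ κ) f n) ⟩
  (∂ κ ⋆ (c · f)) n ∎
  where open ≡-Reasoning

Log-⋆ : ∀ {f g κf κg} → Log f κf → Log g κg → Log (f ⋆ g) (κf ⊞ κg)
Log-⋆ {f} {g} {κf} {κg} Lf Lg n = begin
  ∂ (f ⋆ g) n                                   ≡⟨ ∂-leibniz f g n ⟩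
  (∂ f ⋆ g) n + (f ⋆ ∂ g) n                     ≡⟨ cong₂ _+_ (⋆-congˡ g Lf n) (⋆-congʳ f Lg n) ⟩
  ((∂ κf ⋆ f) ⋆ g) n + (f ⋆ (∂ κg ⋆ g)) n
    ≡⟨ cong₂ _+_ (⋆-assoc (∂ κf) f g n) (sym (⋆-assoc f (∂ κg) g n)) ⟩
  (∂ κf ⋆ (f ⋆ g)) n + ((f ⋆ ∂ κg) ⋆ g) n
    ≡⟨ cong ((∂ κf ⋆ (f ⋆ g)) n +_)
         (trans (⋆-congˡ g (⋆-comm f (∂ κg)) n) (⋆-assoc (∂ κg) f g n)) ⟩
  (∂ κf ⋆ (f ⋆ g)) n + (∂ κg ⋆ (f ⋆ g)) n       ≡⟨ sym (⋆-distribʳ-⊞ (∂ κf) (∂ κg) (f ⋆ g) n) ⟩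
  ((∂ κf ⊞ ∂ κg) ⋆ (f ⋆ g)) n                   ≡⟨ ⋆-congˡ (f ⋆ g) (λ k → sym (∂-⊞ κf κg k)) n ⟩
  (∂ (κf ⊞ κg) ⋆ (f ⋆ g)) n                     ∎
  where open ≡-Reasoning

⋆-agree : ∀ n g h f → (∀ i → i < n → g i ≡ h i) → (g ⋆ f) n - (h ⋆ f) n ≡ (g n - h n) * f 0
⋆-agree zero g h f _ = solve 3 (λ a b c → a :* c :- b :* c := (a :- b) :* c) refl (g 0) (h 0) (f 0)
⋆-agree (suc n) g h f g≡h = begin
  (g 0 * f (suc n) + (shift g ⋆ f) n) - (h 0 * f (suc n) + (shift h ⋆ f) n)
    ≡⟨ cong (λ z → (g 0 * f (suc n) + (shift g ⋆ f) n) - (z * f (suc n) + (shift h ⋆ f) n))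
         (sym (g≡h 0 (s≤s z≤n))) ⟩
  (g 0 * f (suc n) + (shift g ⋆ f) n) - (g 0 * f (suc n) + (shift h ⋆ f) n)
    ≡⟨ solve 3 (λ a x y → (a :+ x) :- (a :+ y) := x :- y) refl
         (g 0 * f (suc n)) ((shift g ⋆ f) n) ((shift h ⋆ f) n) ⟩
  (shift g ⋆ f) n - (shift h ⋆ f) n
    ≡⟨ ⋆-agree n (shift g) (shift h) f (λ i i<n → g≡h (suc i) (s≤s i<n)) ⟩
  (g (suc n) - h (suc n)) * f 0 ∎
  where open ≡-Reasoning

⋆-cancelˡ : ∀ f g h → f 0 ≢ 0ℚ → f ⋆ g ≗ f ⋆ h → g ≗ h
⋆-cancelˡ f g h f0≢0 fg≗fh n = below (suc n) n (s≤s ℕP.≤-refl)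
  where
  open ≡-Reasoning
  below : ∀ m i → i < m → g i ≡ h i
  below (suc m) i (s≤s i≤m) with ℕP.m≤n⇒m<n∨m≡n i≤m
  ... | inj₁ i<m = below m i i<m
  ... | inj₂ refl = x-y≡0⇒x≡y (*-cancelˡ-≢0 f0≢0 (begin
    f 0 * (g i - h i)        ≡⟨ ℚP.*-comm (f 0) (g i - h i) ⟩
    (g i - h i) * f 0        ≡⟨ sym (⋆-agree i g h f (below i)) ⟩
    (g ⋆ f) i - (h ⋆ f) i
      ≡⟨ cong (_- (h ⋆ f) i) (trans (⋆-comm g f i) (trans (fg≗fh i) (⋆-comm f h i))) ⟩
    (h ⋆ f) i - (h ⋆ f) i    ≡⟨ ℚP.+-inverseʳ ((h ⋆ f) i) ⟩
    0ℚ                       ≡⟨ sym (ℚP.*-zeroʳ (f 0)) ⟩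
    f 0 * 0ℚ                 ∎))
    where
    x-y≡0⇒x≡y : ∀ {x y} → x - y ≡ 0ℚ → x ≡ y
    x-y≡0⇒x≡y {x} {y} x-y≡0 = trans (solve 2 (λ a b → a := (a :- b) :+ b) refl x y)
      (trans (cong (_+ y) x-y≡0) (ℚP.+-identityˡ y))

Log-unique : ∀ {f κ κ′} → f 0 ≢ 0ℚ → Log f κ → Log f κ′ → κ 0 ≡ κ′ 0 → κ ≗ κ′
Log-unique nz L L′ κ0≡κ′0 zero = κ0≡κ′0
Log-unique {f} {κ} {κ′} nz L L′ κ0≡κ′0 (suc n) =
  *-cancelˡ-≢0 (ι-suc≢0 n) (⋆-cancelˡ f (∂ κ) (∂ κ′) nz
  (λ k → trans (⋆-comm f (∂ κ) k) (trans (sym (L k)) (trans (L′ k) (⋆-comm (∂ κ′) f k)))) n)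

Log-quotient : ∀ {f g h κf κh} → f ⋆ g ≗ h → Log f κf → Log h κh → f 0 ≢ 0ℚ → Log g (κh ⊟ κf)
Log-quotient {f} {g} {h} {κf} {κh} fg≗h Lf Lh f0≢0 = ⋆-cancelˡ f (∂ g) (∂ (κh ⊟ κf) ⋆ g) f0≢0 f∂g
  where
  open ≡-Reasoning
  f∂g : f ⋆ ∂ g ≗ f ⋆ (∂ (κh ⊟ κf) ⋆ g)
  f∂g n = begin
    (f ⋆ ∂ g) n
      ≡⟨ solve 2 (λ a b → b := (a :+ b) :- a) refl ((∂ f ⋆ g) n) ((f ⋆ ∂ g) n) ⟩
    ((∂ f ⋆ g) n + (f ⋆ ∂ g) n) - (∂ f ⋆ g) n
      ≡⟨ cong₂ _-_ (sym (∂-leibniz f g n)) (⋆-congˡ g Lf n) ⟩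
    ∂ (f ⋆ g) n - ((∂ κf ⋆ f) ⋆ g) n
      ≡⟨ cong₂ _-_ (cong (ι (suc n) *_) (fg≗h (suc n))) (⋆-assoc (∂ κf) f g n) ⟩
    ∂ h n - (∂ κf ⋆ (f ⋆ g)) n
      ≡⟨ cong (_- (∂ κf ⋆ (f ⋆ g)) n) (trans (Lh n) (⋆-congʳ (∂ κh) (λ k → sym (fg≗h k)) n)) ⟩
    (∂ κh ⋆ (f ⋆ g)) n - (∂ κf ⋆ (f ⋆ g)) n
      ≡⟨ sym (⋆-distribʳ-⊟ (∂ κh) (∂ κf) (f ⋆ g) n) ⟩
    ((∂ κh ⊟ ∂ κf) ⋆ (f ⋆ g)) n
      ≡⟨ sym (⋆-assoc (∂ κh ⊟ ∂ κf) f g n) ⟩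
    (((∂ κh ⊟ ∂ κf) ⋆ f) ⋆ g) n
      ≡⟨ trans (⋆-congˡ g (⋆-comm (∂ κh ⊟ ∂ κf) f) n) (⋆-assoc f (∂ κh ⊟ ∂ κf) g n) ⟩
    (f ⋆ ((∂ κh ⊟ ∂ κf) ⋆ g)) n
      ≡⟨ ⋆-congʳ f (⋆-congˡ g (λ k → sym (∂-⊟ κh κf k))) n ⟩
    (f ⋆ (∂ (κh ⊟ κf) ⋆ g)) n ∎

dilate : ℚ → Series → Series
dilate a f n = (a ^ n) * f n

⋆-dilate : ∀ a f g → dilate a f ⋆ dilate a g ≗ dilate a (f ⋆ g)
⋆-dilate a f g zero =
  solve 2 (λ x y → (con 1ℚ :* x) :* (con 1ℚ :* y) := con 1ℚ :* (x :* y)) refl (f 0) (g 0)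
⋆-dilate a f g (suc n) = begin
  dilate a f 0 * dilate a g (suc n) + (shift (dilate a f) ⋆ dilate a g) n
    ≡⟨ cong (dilate a f 0 * dilate a g (suc n) +_)
         (trans (⋆-congˡ (dilate a g) (λ k → ℚP.*-assoc a (a ^ k) (f (suc k))) n)
                (⋆-scaleˡ a (dilate a (shift f)) (dilate a g) n)) ⟩
  dilate a f 0 * dilate a g (suc n) + a * (dilate a (shift f) ⋆ dilate a g) n
    ≡⟨ cong (λ z → dilate a f 0 * dilate a g (suc n) + a * z) (⋆-dilate a (shift f) g n) ⟩
  (1ℚ * f 0) * ((a * (a ^ n)) * g (suc n)) + a * ((a ^ n) * (shift f ⋆ g) n)
    ≡⟨ solve 5 (λ a an f0 g1 M → (con 1ℚ :* f0) :* ((a :* an) :* g1) :+ a :* (an :* M)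
                                 := (a :* an) :* (f0 :* g1 :+ M)) refl
         a (a ^ n) (f 0) (g (suc n)) ((shift f ⋆ g) n) ⟩
  (a * (a ^ n)) * (f 0 * g (suc n) + (shift f ⋆ g) n) ∎
  where open ≡-Reasoning

∂-dilate : ∀ a f → ∂ (dilate a f) ≗ a · dilate a (∂ f)
∂-dilate a f n = solve 4 (λ i a an x → i :* ((a :* an) :* x) := a :* (an :* (i :* x))) refl
  (ι (suc n)) a (a ^ n) (f (suc n))

Log-dilate : ∀ {f κ} a → Log f κ → Log (dilate a f) (dilate a κ)
Log-dilate {f} {κ} a L n = begin
  ∂ (dilate a f) n                        ≡⟨ ∂-dilate a f n ⟩
  a * ((a ^ n) * ∂ f n)                   ≡⟨ cong (λ z → a * ((a ^ n) * z)) (L n) ⟩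
  a * ((a ^ n) * (∂ κ ⋆ f) n)             ≡⟨ cong (a *_) (sym (⋆-dilate a (∂ κ) f n)) ⟩
  a * (dilate a (∂ κ) ⋆ dilate a f) n     ≡⟨ sym (⋆-scaleˡ a (dilate a (∂ κ)) (dilate a f) n) ⟩
  ((a · dilate a (∂ κ)) ⋆ dilate a f) n   ≡⟨ ⋆-congˡ (dilate a f) (λ k → sym (∂-dilate a κ k)) n ⟩
  (∂ (dilate a κ) ⋆ dilate a f) n         ∎
  where open ≡-Reasoning

Σ<-cong : ∀ L {f g : ℕ → ℚ} → (∀ i → i < L → f i ≡ g i) → Σ< L f ≡ Σ< L g
Σ<-cong zero f≡g = refl
Σ<-cong (suc L) f≡g = cong₂ _+_ (Σ<-cong L (λ i i<L → f≡g i (ℕP.m≤n⇒m≤1+n i<L))) (f≡g L ℕP.≤-refl)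

Σ<-first : ∀ L f → Σ< (suc L) f ≡ f 0 + Σ< L (f ∘ suc)
Σ<-first zero f = trans (ℚP.+-identityˡ (f 0)) (sym (ℚP.+-identityʳ (f 0)))
Σ<-first (suc L) f =
  trans (cong (_+ f (suc L)) (Σ<-first L f)) (ℚP.+-assoc (f 0) (Σ< L (f ∘ suc)) (f (suc L)))

Σ<-scale : ∀ L x f → Σ< L (λ j → x * f j) ≡ x * Σ< L f
Σ<-scale zero x f = sym (ℚP.*-zeroʳ x)
Σ<-scale (suc L) x f =
  trans (cong (_+ x * f L) (Σ<-scale L x f)) (sym (ℚP.*-distribˡ-+ x (Σ< L f) (f L)))

⋆-Σ< : ∀ L h (F : ℕ → Series) → h ⋆ (λ m → Σ< L (λ j → F j m)) ≗ λ n → Σ< L (λ j → (h ⋆ F j) n)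
⋆-Σ< zero h F n = ⋆-zeroʳ h n
⋆-Σ< (suc L) h F n =
  trans (⋆-distribˡ-⊞ h (λ m → Σ< L (λ j → F j m)) (F L) n) (cong (_+ (h ⋆ F L) n) (⋆-Σ< L h F n))

⋆-as-Σ< : ∀ f g n → (f ⋆ g) n ≡ Σ< (suc n) (λ i → f i * g (n ∸ i))
⋆-as-Σ< f g zero = sym (ℚP.+-identityˡ _)
⋆-as-Σ< f g (suc n) = trans (cong (f 0 * g (suc n) +_) (⋆-as-Σ< (shift f) g n))
  (sym (Σ<-first (suc n) (λ i → f i * g (suc n ∸ i))))

-- Polynomials evaluated at q = e^t

eᵗ : Series
eᵗ = exp 1ℚ

-- φ(t) = (e^t − 1)/t = Σ tⁿ/(n+1)!.
φ : Series
φ n = invFact (suc n)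

1^ : ∀ n → 1ℚ ^ n ≡ 1ℚ
1^ zero = refl
1^ (suc n) = trans (ℚP.*-identityˡ (1ℚ ^ n)) (1^ n)

shift-eᵗ : shift eᵗ ≗ φ
shift-eᵗ k = trans (cong (_* invFact (suc k)) (1^ (suc k))) (ℚP.*-identityˡ (invFact (suc k)))

ev : Poly → Series
ev [] = 0ₛ
ev (c ∷ cs) = c · 1ₛ ⊞ eᵗ ⋆ ev cs

ev-at-0 : ∀ p → ev p 0 ≡ evalAt1 p
ev-at-0 [] = refl
ev-at-0 (c ∷ cs) = cong₂ _+_ (ℚP.*-identityʳ c) (trans (ℚP.*-identityˡ (ev cs 0)) (ev-at-0 cs))

ev-expansion : ∀ p n → ev p n ≡ Σ< (length p) (λ j → coeff p j * exp (ι j) n)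
ev-expansion [] n = refl
ev-expansion (c ∷ cs) n = begin
  c * 1ₛ n + (eᵗ ⋆ ev cs) n
    ≡⟨ cong₂ _+_ (cong (c *_) (sym (exp-0 n))) (⋆-congʳ eᵗ (ev-expansion cs) n) ⟩
  c * exp 0ℚ n + (eᵗ ⋆ (λ m → Σ< (length cs) (λ j → coeff cs j * exp (ι j) m))) n
    ≡⟨ cong (c * exp 0ℚ n +_) (⋆-Σ< (length cs) eᵗ (λ j m → coeff cs j * exp (ι j) m) n) ⟩
  c * exp 0ℚ n + Σ< (length cs) (λ j → (eᵗ ⋆ (coeff cs j · exp (ι j))) n)
    ≡⟨ cong (c * exp 0ℚ n +_) (Σ<-cong (length cs) (λ j _ → shifted j)) ⟩
  c * exp 0ℚ n + Σ< (length cs) (λ j → coeff cs j * exp (ι (suc j)) n)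
    ≡⟨ sym (Σ<-first (length cs) (λ j → coeff (c ∷ cs) j * exp (ι j) n)) ⟩
  Σ< (length (c ∷ cs)) (λ j → coeff (c ∷ cs) j * exp (ι j) n) ∎
  where
  open ≡-Reasoning
  shifted : ∀ j → (eᵗ ⋆ (coeff cs j · exp (ι j))) n ≡ coeff cs j * exp (ι (suc j)) n
  shifted j = trans (⋆-scaleʳ (coeff cs j) eᵗ (exp (ι j)) n)
    (cong (coeff cs j *_) (trans (exp-+ 1ℚ (ι j) n) (cong (λ z → exp z n) (sym (ι-suc j)))))

ev-⊕ : ∀ p q → ev (p ⊕ q) ≗ ev p ⊞ ev q
ev-⊕ [] q n = sym (ℚP.+-identityˡ (ev q n))
ev-⊕ (p ∷ ps) [] n = sym (ℚP.+-identityʳ (ev (p ∷ ps) n))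
ev-⊕ (p ∷ ps) (q ∷ qs) n = begin
  (p + q) * 1ₛ n + (eᵗ ⋆ ev (ps ⊕ qs)) n
    ≡⟨ cong ((p + q) * 1ₛ n +_) (trans (⋆-congʳ eᵗ (ev-⊕ ps qs) n) (⋆-distribˡ-⊞ eᵗ (ev ps) (ev qs) n)) ⟩
  (p + q) * 1ₛ n + ((eᵗ ⋆ ev ps) n + (eᵗ ⋆ ev qs) n)
    ≡⟨ solve 5 (λ p q d a b → (p :+ q) :* d :+ (a :+ b) := (p :* d :+ a) :+ (q :* d :+ b)) refl
         p q (1ₛ n) ((eᵗ ⋆ ev ps) n) ((eᵗ ⋆ ev qs) n) ⟩
  (p * 1ₛ n + (eᵗ ⋆ ev ps) n) + (q * 1ₛ n + (eᵗ ⋆ ev qs) n) ∎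
  where open ≡-Reasoning

ev-scale : ∀ x p → ev (scale x p) ≗ x · ev p
ev-scale x [] n = sym (ℚP.*-zeroʳ x)
ev-scale x (c ∷ cs) n = begin
  x * c * 1ₛ n + (eᵗ ⋆ ev (scale x cs)) n
    ≡⟨ cong (x * c * 1ₛ n +_) (trans (⋆-congʳ eᵗ (ev-scale x cs) n) (⋆-scaleʳ x eᵗ (ev cs) n)) ⟩
  x * c * 1ₛ n + x * (eᵗ ⋆ ev cs) n
    ≡⟨ solve 4 (λ x c d a → x :* c :* d :+ x :* a := x :* (c :* d :+ a)) refl x c (1ₛ n) ((eᵗ ⋆ ev cs) n) ⟩
  x * (c * 1ₛ n + (eᵗ ⋆ ev cs) n) ∎
  where open ≡-Reasoning

ev-⊛ : ∀ p q → ev (p ⊛ q) ≗ ev p ⋆ ev q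
ev-⊛ [] q n = sym (⋆-zeroˡ (ev q) n)
ev-⊛ (p ∷ ps) q n = begin
  ev (scale p q ⊕ (0ℚ ∷ (ps ⊛ q))) n
    ≡⟨ ev-⊕ (scale p q) (0ℚ ∷ (ps ⊛ q)) n ⟩
  ev (scale p q) n + (0ℚ * 1ₛ n + (eᵗ ⋆ ev (ps ⊛ q)) n)
    ≡⟨ cong₂ _+_ (ev-scale p q n)
         (trans (cong (_+ (eᵗ ⋆ ev (ps ⊛ q)) n) (ℚP.*-zeroˡ (1ₛ n))) (ℚP.+-identityˡ _)) ⟩
  p * ev q n + (eᵗ ⋆ ev (ps ⊛ q)) n
    ≡⟨ cong₂ _+_ (sym (trans (⋆-scaleˡ p 1ₛ (ev q) n) (cong (p *_) (⋆-identityˡ (ev q) n))))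
         (trans (⋆-congʳ eᵗ (ev-⊛ ps q) n) (sym (⋆-assoc eᵗ (ev ps) (ev q) n))) ⟩
  ((p · 1ₛ) ⋆ ev q) n + ((eᵗ ⋆ ev ps) ⋆ ev q) n
    ≡⟨ sym (⋆-distribʳ-⊞ (p · 1ₛ) (eᵗ ⋆ ev ps) (ev q) n) ⟩
  (ev (p ∷ ps) ⋆ ev q) n ∎
  where open ≡-Reasoning

ev-zero : ∀ p → (∀ j → coeff p j ≡ 0ℚ) → ev p ≗ 0ₛ
ev-zero [] _ n = refl
ev-zero (c ∷ cs) p≡0 n =
  trans (cong₂ _+_ (trans (cong (_* 1ₛ n) (p≡0 0)) (ℚP.*-zeroˡ (1ₛ n)))
                   (trans (⋆-congʳ eᵗ (ev-zero cs (p≡0 ∘ suc)) n) (⋆-zeroʳ eᵗ n)))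
        (ℚP.+-identityˡ 0ℚ)

-- ev only depends on the coefficients (trailing zeros are invisible).
ev-coeff : ∀ p q → (∀ j → coeff p j ≡ coeff q j) → ev p ≗ ev q
ev-coeff [] q p≡q n = sym (ev-zero q (λ j → sym (p≡q j)) n)
ev-coeff (c ∷ cs) [] p≡q n = ev-zero (c ∷ cs) p≡q n
ev-coeff (c ∷ cs) (d ∷ ds) p≡q n =
  cong₂ _+_ (cong (_* 1ₛ n) (p≡q 0)) (⋆-congʳ eᵗ (ev-coeff cs ds (p≡q ∘ suc)) n)

∏ₛ : (k : ℕ) → (Fin k → Series) → Series
∏ₛ zero F = 1ₛ
∏ₛ (suc k) F = F fzero ⋆ ∏ₛ k (F ∘ fsuc)

ev-∏P : ∀ k P → ev (∏P k P) ≗ ∏ₛ k (ev ∘ P)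
ev-∏P zero P n =
  trans (cong (1ℚ * 1ₛ n +_) (⋆-zeroʳ eᵗ n)) (trans (ℚP.+-identityʳ _) (ℚP.*-identityˡ (1ₛ n)))
ev-∏P (suc k) P n = trans (ev-⊛ (P fzero) (∏P k (P ∘ fsuc)) n) (⋆-congʳ (ev (P fzero)) (ev-∏P k (P ∘ fsuc)) n)

nth-snoc-< : ∀ xs (y : ℚ) j → j < length xs → coeff (xs ++ y ∷ []) j ≡ coeff xs j
nth-snoc-< (x ∷ xs) y zero _ = refl
nth-snoc-< (x ∷ xs) y (suc j) (s≤s j<n) = nth-snoc-< xs y j j<n

nth-snoc-length : ∀ xs (y : ℚ) → coeff (xs ++ y ∷ []) (length xs) ≡ y
nth-snoc-length [] y = refl
nth-snoc-length (x ∷ xs) y = nth-snoc-length xs y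

length-snoc : ∀ xs (y : ℚ) → length (xs ++ y ∷ []) ≡ suc (length xs)
length-snoc [] y = refl
length-snoc (x ∷ xs) y = cong suc (length-snoc xs y)

module GrowingList (L : ℕ → List ℚ) (grow : ∀ n → Σ[ v ∈ ℚ ] L (suc n) ≡ L n ++ v ∷ [])
                   (length-L0 : length (L 0) ≡ 1) where

  new : ℕ → ℚ
  new n = proj₁ (grow n)

  length-L : ∀ n → length (L n) ≡ suc n
  length-L zero = length-L0
  length-L (suc n) rewrite proj₂ (grow n) = trans (length-snoc (L n) (new n)) (cong suc (length-L n))

  entry-stable : ∀ n j → j ≤ n → coeff (L n) j ≡ coeff (L j) j
  entry-stable zero zero z≤n = refl
  entry-stable (suc n) j j≤1+n with ℕP.m≤n⇒m<n∨m≡n j≤1+n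
  ... | inj₂ refl = refl
  ... | inj₁ (s≤s j≤n) = trans (cong (λ l → coeff l j) (proj₂ (grow n)))
          (trans (nth-snoc-< (L n) (new n) j (subst (j <_) (sym (length-L n)) (s≤s j≤n)))
                 (entry-stable n j j≤n))

  entry-new : ∀ n → coeff (L (suc n)) (suc n) ≡ new n
  entry-new n = trans (cong (λ l → coeff l (suc n)) (proj₂ (grow n)))
    (subst (λ m → coeff (L n ++ new n ∷ []) m ≡ new n) (length-L n) (nth-snoc-length (L n) (new n)))

bernoulli-suc : ∀ n → bernoulli (suc n)
  ≡ 0ℚ - Σ< (suc n) (λ j → ι (suc n C j) * sgn (suc n ∸ j) * bernoulli j * (1ℚ ÷₀ ι (suc (suc n ∸ j))))
bernoulli-suc n = trans (entry-new n) (cong (0ℚ -_) (Σ<-cong (suc n) (λ j j<1+n →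
  cong (λ z → ι (suc n C j) * sgn (suc n ∸ j) * z * (1ℚ ÷₀ ι (suc (suc n ∸ j))))
       (entry-stable n j (ℕP.≤-pred j<1+n)))))
  where open GrowingList bernoulliUpTo (λ n → _ , refl) refl

cumulant-suc : ∀ m n → cumulantFromMoments m (suc n)
  ≡ m (suc n) - Σ< (suc n) (λ j → ι (n C (j ∸ 1)) * cumulantFromMoments m j * m (suc n ∸ j))
cumulant-suc m n = trans (entry-new n) (cong (m (suc n) -_) (Σ<-cong (suc n) (λ j j<1+n →
  cong (λ z → ι (n C (j ∸ 1)) * z * m (suc n ∸ j)) (entry-stable n j (ℕP.≤-pred j<1+n)))))
  where open GrowingList (cumulantsUpTo m) (λ n → _ , refl) refl

-- The Bernoulli series

bernoulliSeries : Series
bernoulliSeries n = bernoulli n * invFact n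

-- ψ(t) = (1 − e^{−t})/t = Σ (−1)ⁿ tⁿ/(n+1)!.
ψ : Series
ψ n = sgn n * invFact (suc n)

bernoulli*ψ : bernoulliSeries ⋆ ψ ≗ 1ₛ
bernoulli*ψ zero = refl
bernoulli*ψ (suc n) = begin
  (bernoulliSeries ⋆ ψ) r                            ≡⟨ ⋆-as-Σ< bernoulliSeries ψ r ⟩
  Σ< r term + bernoulliSeries r * ψ (r ∸ r)
    ≡⟨ cong (λ z → Σ< r term + bernoulliSeries r * ψ z) (ℕP.n∸n≡0 r) ⟩
  Σ< r term + bernoulliSeries r * 1ℚ
    ≡⟨ cong₂ _+_ (Σ<-cong r (λ i i<r → sym (term≡ i i<r)))
         (trans (ℚP.*-identityʳ (bernoulliSeries r)) (cong (_* invFact r) (bernoulli-suc n))) ⟩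
  Σ< r (λ i → invFact r * summand i) + (0ℚ - Σ< r summand) * invFact r
    ≡⟨ cong (_+ (0ℚ - Σ< r summand) * invFact r) (Σ<-scale r (invFact r) summand) ⟩
  invFact r * Σ< r summand + (0ℚ - Σ< r summand) * invFact r
    ≡⟨ solve 2 (λ f u → f :* u :+ (con 0ℚ :- u) :* f := con 0ℚ) refl (invFact r) (Σ< r summand) ⟩
  0ℚ ∎
  where
  open ≡-Reasoning
  r = suc n
  term : ℕ → ℚ
  term i = bernoulliSeries i * ψ (r ∸ i)
  summand : ℕ → ℚ
  summand j = ι (r C j) * sgn (r ∸ j) * bernoulli j * (1ℚ ÷₀ ι (suc (r ∸ j)))
  term≡ : ∀ i → i < r → invFact r * summand i ≡ term i
  term≡ i i<r = begin
    invFact r * (ι (r C i) * s * bernoulli i * (1ℚ ÷₀ ι (suc (r ∸ i))))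
      ≡⟨ cong (λ z → invFact r * (ι (r C i) * s * bernoulli i * z))
           (trans (÷₀-ι-suc 1ℚ (r ∸ i)) (ℚP.*-identityˡ _)) ⟩
    invFact r * (ι (r C i) * s * bernoulli i * recip (r ∸ i))
      ≡⟨ solve 5 (λ f c s b v → f :* (c :* s :* b :* v) := (c :* f) :* s :* b :* v) refl
           (invFact r) (ι (r C i)) s (bernoulli i) (recip (r ∸ i)) ⟩
    (ι (r C i) * invFact r) * s * bernoulli i * recip (r ∸ i)
      ≡⟨ cong (λ z → z * s * bernoulli i * recip (r ∸ i)) (binomial*invFact r i (ℕP.<⇒≤ i<r)) ⟩
    (invFact i * invFact (r ∸ i)) * s * bernoulli i * recip (r ∸ i)
      ≡⟨ solve 5 (λ a b s c v → (a :* b) :* s :* c :* v := c :* a :* (s :* (b :* v))) refl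
           (invFact i) (invFact (r ∸ i)) s (bernoulli i) (recip (r ∸ i)) ⟩
    bernoulli i * invFact i * (s * (invFact (r ∸ i) * recip (r ∸ i))) ∎
    where s = sgn (r ∸ i)

-1ℚ : ℚ
-1ℚ = 0ℚ - 1ℚ

-1^ : ∀ n → -1ℚ ^ n ≡ sgn n
-1^ zero = refl
-1^ (suc n) = trans (cong (-1ℚ *_) (-1^ n)) (solve 1 (λ s → (con 0ℚ :- con 1ℚ) :* s := con 0ℚ :- s) refl (sgn n))

timesT-ψ : timesT ψ ≗ 1ₛ ⊟ exp -1ℚ
timesT-ψ zero = refl
timesT-ψ (suc n) = begin
  sgn n * invFact (suc n)
    ≡⟨ solve 2 (λ s F → s :* F := con 0ℚ :- (con 0ℚ :- con 1ℚ) :* s :* F) refl (sgn n) (invFact (suc n)) ⟩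
  0ℚ - -1ℚ * sgn n * invFact (suc n)        ≡⟨ cong (λ z → 0ℚ - -1ℚ * z * invFact (suc n)) (sym (-1^ n)) ⟩
  0ℚ - -1ℚ * (-1ℚ ^ n) * invFact (suc n)    ∎
  where open ≡-Reasoning

ψ*eᵗ : ψ ⋆ eᵗ ≗ φ
ψ*eᵗ n = begin
  (ψ ⋆ eᵗ) n                                 ≡⟨ sym (⋆-timesT ψ eᵗ n) ⟩
  (timesT ψ ⋆ eᵗ) (suc n)                    ≡⟨ ⋆-congˡ eᵗ timesT-ψ (suc n) ⟩
  ((1ₛ ⊟ exp -1ℚ) ⋆ eᵗ) (suc n)              ≡⟨ ⋆-distribʳ-⊟ 1ₛ (exp -1ℚ) eᵗ (suc n) ⟩
  (1ₛ ⋆ eᵗ) (suc n) - (exp -1ℚ ⋆ eᵗ) (suc n)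
    ≡⟨ cong₂ _-_ (⋆-identityˡ eᵗ (suc n)) (exp-+ -1ℚ 1ℚ (suc n)) ⟩
  eᵗ (suc n) - exp 0ℚ (suc n)                ≡⟨ cong₂ _-_ (shift-eᵗ n) (exp-0 (suc n)) ⟩
  φ n - 0ℚ                                   ≡⟨ ℚP.+-identityʳ (φ n) ⟩
  φ n                                        ∎
  where open ≡-Reasoning

bernoulli*φ : bernoulliSeries ⋆ φ ≗ eᵗ
bernoulli*φ n = begin
  (bernoulliSeries ⋆ φ) n          ≡⟨ ⋆-congʳ bernoulliSeries (λ k → sym (ψ*eᵗ k)) n ⟩
  (bernoulliSeries ⋆ (ψ ⋆ eᵗ)) n   ≡⟨ sym (⋆-assoc bernoulliSeries ψ eᵗ n) ⟩
  ((bernoulliSeries ⋆ ψ) ⋆ eᵗ) n   ≡⟨ ⋆-congˡ eᵗ bernoulli*ψ n ⟩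
  (1ₛ ⋆ eᵗ) n                      ≡⟨ ⋆-identityˡ eᵗ n ⟩
  eᵗ n                             ∎
  where open ≡-Reasoning

β : Series
β zero = 0ℚ
β (suc n) = bernoulliSeries (suc n) * recip n

∂-β : ∂ β ≗ shift bernoulliSeries
∂-β n = begin
  ι (suc n) * (B * recip n) ≡⟨ solve 3 (λ i b v → i :* (b :* v) := b :* (i :* v)) refl (ι (suc n)) B (recip n) ⟩
  B * (ι (suc n) * recip n) ≡⟨ cong (B *_) (ι-recip n) ⟩
  B * 1ℚ                    ≡⟨ ℚP.*-identityʳ B ⟩
  B                         ∎
  where
  open ≡-Reasoning
  B = bernoulliSeries (suc n)

-- β is a logarithm of φ: comparing coefficients of t^{n+1} in B(t) φ(t) = e^t.
Log-φ : Log φ β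
Log-φ n = begin
  ι (suc n) * F₂
    ≡⟨ solve 2 (λ u F → u :* F := (con 1ℚ :+ u) :* F :- con 1ℚ :* F) refl (ι (suc n)) F₂ ⟩
  (1ℚ + ι (suc n)) * F₂ - 1ℚ * F₂
    ≡⟨ cong (λ z → z * F₂ - 1ℚ * F₂) (sym (ι-suc (suc n))) ⟩
  ι (2 ℕ.+ n) * F₂ - 1ℚ * F₂
    ≡⟨ cong (_- 1ℚ * F₂) (trans (ι-suc*invFact (suc n)) (sym (trans (bernoulli*φ (suc n)) (shift-eᵗ n)))) ⟩
  (bernoulliSeries ⋆ φ) (suc n) - 1ℚ * F₂
    ≡⟨ solve 2 (λ F M → con 1ℚ :* F :+ M :- con 1ℚ :* F := M) refl F₂ ((shift bernoulliSeries ⋆ φ) n) ⟩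
  (shift bernoulliSeries ⋆ φ) n
    ≡⟨ sym (⋆-congˡ φ ∂-β n) ⟩
  (∂ β ⋆ φ) n ∎
  where
  open ≡-Reasoning
  F₂ = invFact (2 ℕ.+ n)

qintExp : ℕ → Series
qintExp a = ev (qint a)

telescope : ∀ a → eᵗ ⋆ qintExp a ⊞ 1ₛ ≗ qintExp a ⊞ exp (ι a)
telescope zero n = trans (cong (_+ 1ₛ n) (⋆-zeroʳ eᵗ n))
  (trans (ℚP.+-identityˡ (1ₛ n)) (sym (trans (ℚP.+-identityˡ _) (exp-0 n))))
telescope (suc a) n = begin
  (eᵗ ⋆ G′) n + 1ₛ n
    ≡⟨ cong (_+ 1ₛ n) (trans (⋆-distribˡ-⊞ eᵗ (1ℚ · 1ₛ) (eᵗ ⋆ G) n)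
         (cong (_+ (eᵗ ⋆ (eᵗ ⋆ G)) n) (trans (⋆-scaleʳ 1ℚ eᵗ 1ₛ n) (cong (1ℚ *_) (⋆-identityʳ eᵗ n))))) ⟩
  1ℚ * eᵗ n + (eᵗ ⋆ (eᵗ ⋆ G)) n + 1ₛ n
    ≡⟨ solve 3 (λ e w d → con 1ℚ :* e :+ w :+ d := con 1ℚ :* d :+ (w :+ e)) refl
         (eᵗ n) ((eᵗ ⋆ (eᵗ ⋆ G)) n) (1ₛ n) ⟩
  1ℚ * 1ₛ n + ((eᵗ ⋆ (eᵗ ⋆ G)) n + eᵗ n)
    ≡⟨ cong (1ℚ * 1ₛ n +_) induction ⟩
  1ℚ * 1ₛ n + ((eᵗ ⋆ G) n + exp (ι (suc a)) n)
    ≡⟨ sym (ℚP.+-assoc (1ℚ * 1ₛ n) ((eᵗ ⋆ G) n) (exp (ι (suc a)) n)) ⟩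
  G′ n + exp (ι (suc a)) n ∎
  where
  open ≡-Reasoning
  G = qintExp a
  G′ = qintExp (suc a)
  induction : (eᵗ ⋆ (eᵗ ⋆ G)) n + eᵗ n ≡ (eᵗ ⋆ G) n + exp (ι (suc a)) n
  induction = begin
    (eᵗ ⋆ (eᵗ ⋆ G)) n + eᵗ n              ≡⟨ cong ((eᵗ ⋆ (eᵗ ⋆ G)) n +_) (sym (⋆-identityʳ eᵗ n)) ⟩
    (eᵗ ⋆ (eᵗ ⋆ G)) n + (eᵗ ⋆ 1ₛ) n       ≡⟨ sym (⋆-distribˡ-⊞ eᵗ (eᵗ ⋆ G) 1ₛ n) ⟩
    (eᵗ ⋆ (eᵗ ⋆ G ⊞ 1ₛ)) n                ≡⟨ ⋆-congʳ eᵗ (telescope a) n ⟩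
    (eᵗ ⋆ (G ⊞ exp (ι a))) n              ≡⟨ ⋆-distribˡ-⊞ eᵗ G (exp (ι a)) n ⟩
    (eᵗ ⋆ G) n + (eᵗ ⋆ exp (ι a)) n
      ≡⟨ cong ((eᵗ ⋆ G) n +_) (trans (exp-+ 1ℚ (ι a) n) (cong (λ z → exp z n) (sym (ι-suc a)))) ⟩
    (eᵗ ⋆ G) n + exp (ι (suc a)) n        ∎

-- Dividing the telescoping identity by t: φ(t) [a]_{e^t} = a φ(at).
φ*qintExp : ∀ a → φ ⋆ qintExp a ≗ ι a · dilate (ι a) φ
φ*qintExp a n = begin
  (φ ⋆ G) n
    ≡⟨ solve 2 (λ g M → M := con 1ℚ :* g :+ M :+ con 0ℚ :- g) refl (G (suc n)) ((φ ⋆ G) n) ⟩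
  1ℚ * G (suc n) + (φ ⋆ G) n + 0ℚ - G (suc n)
    ≡⟨ cong (λ z → 1ℚ * G (suc n) + z + 0ℚ - G (suc n)) (sym (⋆-congˡ G shift-eᵗ n)) ⟩
  (eᵗ ⋆ G) (suc n) + 1ₛ (suc n) - G (suc n)
    ≡⟨ cong (_- G (suc n)) (telescope a (suc n)) ⟩
  G (suc n) + exp (ι a) (suc n) - G (suc n)
    ≡⟨ solve 2 (λ g z → g :+ z :- g := z) refl (G (suc n)) (exp (ι a) (suc n)) ⟩
  exp (ι a) (suc n)
    ≡⟨ ℚP.*-assoc (ι a) (ι a ^ n) (invFact (suc n)) ⟩
  ι a * dilate (ι a) φ n ∎
  where
  open ≡-Reasoning
  G = qintExp a

qintExp-at-0 : ∀ a → qintExp a 0 ≡ ι a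
qintExp-at-0 a = trans (sym (ℚP.*-identityˡ (qintExp a 0))) (trans (φ*qintExp a 0) (ℚP.*-identityʳ (ι a)))

logQint : ℕ → Series
logQint a = dilate (ι a) β ⊟ β

-- [a]_{e^t} = a φ(at)/φ(t), and β(at), β(t) are logarithms of φ(at), φ(t).
Log-qintExp : ∀ a → Log (qintExp a) (logQint a)
Log-qintExp a = Log-quotient {κf = β} {κh = dilate (ι a) β} (φ*qintExp a) Log-φ
  (Log-scale {κ = dilate (ι a) β} (ι a) (Log-dilate {κ = β} (ι a) Log-φ)) (invFact≢0 1)

qintProduct : (k : ℕ) → (Fin k → ℕ) → Series
qintProduct k a = ∏ₛ k (qintExp ∘ a)

logQintSum : (k : ℕ) → (Fin k → ℕ) → Series
logQintSum k a n = ΣFin k (λ i → logQint (a i) n)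

Log-qintProduct : ∀ k a → Log (qintProduct k a) (logQintSum k a)
Log-qintProduct zero a = Log-1
Log-qintProduct (suc k) a =
  Log-⋆ {κf = logQint (a fzero)} {κg = logQintSum k (a ∘ fsuc)}
    (Log-qintExp (a fzero)) (Log-qintProduct k (a ∘ fsuc))

qintProduct-at-0≢0 : ∀ k a → (∀ i → 0 < a i) → qintProduct k a 0 ≢ 0ℚ
qintProduct-at-0≢0 zero a _ = ℚP.1≢0
qintProduct-at-0≢0 (suc k) a a>0 = *-≢0 (subst (_≢ 0ℚ) (sym (qintExp-at-0 (a fzero))) (ι≢0 (a>0 fzero)))
                                     (qintProduct-at-0≢0 k (a ∘ fsuc) (a>0 ∘ fsuc))

-- The moment generating function and the cumulants

mgf : (ℕ → ℚ) → Series
mgf m zero = 1ℚ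
mgf m (suc n) = m (suc n) * invFact (suc n)

cumulantSeries : (ℕ → ℚ) → Series
cumulantSeries m n = cumulantFromMoments m n * invFact n

∂-cumulantSeries : ∀ m i → ∂ (cumulantSeries m) i ≡ cumulantFromMoments m (suc i) * invFact i
∂-cumulantSeries m i = trans
  (solve 3 (λ a b c → a :* (b :* c) := b :* (a :* c)) refl (ι (suc i)) (cumulantFromMoments m (suc i)) (invFact (suc i)))
  (cong (cumulantFromMoments m (suc i) *_) (ι-suc*invFact i))

-- The recursion for the cumulants is the coefficientwise form of M' = K' M.
Log-mgf : ∀ m → Log (mgf m) (cumulantSeries m)
Log-mgf m n = begin
  ι (suc n) * (m (suc n) * invFact (suc n))
    ≡⟨ solve 3 (λ i a f → i :* (a :* f) := a :* (i :* f)) refl (ι (suc n)) (m (suc n)) (invFact (suc n)) ⟩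
  m (suc n) * (ι (suc n) * invFact (suc n))
    ≡⟨ cong₂ _*_ m≡ (ι-suc*invFact n) ⟩
  (K (suc n) + Σ< (suc n) V) * invFact n
    ≡⟨ cong (λ z → (K (suc n) + z) * invFact n) (trans (Σ<-first n V) (cong (_+ Σ< n (V ∘ suc)) V0≡0)) ⟩
  (K (suc n) + (0ℚ + Σ< n (V ∘ suc))) * invFact n
    ≡⟨ solve 3 (λ k s f → (k :+ (con 0ℚ :+ s)) :* f := f :* s :+ k :* f :* con 1ℚ) refl
         (K (suc n)) (Σ< n (V ∘ suc)) (invFact n) ⟩
  invFact n * Σ< n (V ∘ suc) + K (suc n) * invFact n * 1ℚ
    ≡⟨ cong₂ _+_ (sym (Σ<-scale n (invFact n) (V ∘ suc)))
         (cong₂ _*_ (sym (∂-cumulantSeries m n)) (cong (mgf m) (sym (ℕP.n∸n≡0 n)))) ⟩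
  Σ< n (λ i → invFact n * V (suc i)) + ∂ (cumulantSeries m) n * mgf m (n ∸ n)
    ≡⟨ cong (_+ ∂ (cumulantSeries m) n * mgf m (n ∸ n)) (Σ<-cong n term≡) ⟩
  Σ< (suc n) (λ i → ∂ (cumulantSeries m) i * mgf m (n ∸ i))
    ≡⟨ sym (⋆-as-Σ< (∂ (cumulantSeries m)) (mgf m) n) ⟩
  (∂ (cumulantSeries m) ⋆ mgf m) n ∎
  where
  open ≡-Reasoning
  K = cumulantFromMoments m
  V : ℕ → ℚ
  V j = ι (n C (j ∸ 1)) * K j * m (suc n ∸ j)
  m≡ : m (suc n) ≡ K (suc n) + Σ< (suc n) V
  m≡ = trans (solve 2 (λ x s → x := x :- s :+ s) refl (m (suc n)) (Σ< (suc n) V))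
             (cong (_+ Σ< (suc n) V) (sym (cumulant-suc m n)))
  V0≡0 : V 0 ≡ 0ℚ
  V0≡0 = trans (cong (_* m (suc n)) (ℚP.*-zeroʳ (ι (n C 0)))) (ℚP.*-zeroˡ (m (suc n)))
  term≡ : ∀ i → i < n → invFact n * V (suc i) ≡ ∂ (cumulantSeries m) i * mgf m (n ∸ i)
  term≡ i i<n = begin
    invFact n * (ι (n C i) * K (suc i) * m (n ∸ i))
      ≡⟨ solve 4 (λ f c k x → f :* (c :* k :* x) := (c :* f) :* k :* x) refl
           (invFact n) (ι (n C i)) (K (suc i)) (m (n ∸ i)) ⟩
    (ι (n C i) * invFact n) * K (suc i) * m (n ∸ i)
      ≡⟨ cong (λ z → z * K (suc i) * m (n ∸ i)) (binomial*invFact n i (ℕP.<⇒≤ i<n)) ⟩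
    (invFact i * invFact (n ∸ i)) * K (suc i) * m (n ∸ i)
      ≡⟨ solve 4 (λ a b k x → (a :* b) :* k :* x := (k :* a) :* (x :* b)) refl
           (invFact i) (invFact (n ∸ i)) (K (suc i)) (m (n ∸ i)) ⟩
    (K (suc i) * invFact i) * (m (n ∸ i) * invFact (n ∸ i))
      ≡⟨ cong₂ _*_ (sym (∂-cumulantSeries m i)) (mgf-pos (n ∸ i) (ℕP.m<n⇒0<n∸m i<n)) ⟩
    ∂ (cumulantSeries m) i * mgf m (n ∸ i) ∎
    where
    mgf-pos : ∀ j → 0 < j → m j * invFact j ≡ mgf m j
    mgf-pos (suc j) _ = refl

ev≡mgf : ∀ c → evalAt1 c ≢ 0ℚ → ev c ≗ evalAt1 c · mgf (moment c)
ev≡mgf c c1≢0 zero = trans (ev-at-0 c) (sym (ℚP.*-identityʳ (evalAt1 c)))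
ev≡mgf c c1≢0 (suc n) = begin
  ev c r                                          ≡⟨ ev-expansion c r ⟩
  Σ< L (λ j → coeff c j * exp (ι j) r)            ≡⟨ Σ<-cong L (λ j _ → term≡ j) ⟩
  Σ< L (λ j → (e * F) * ((ι j ^ r) * prob c j))   ≡⟨ Σ<-scale L (e * F) (λ j → (ι j ^ r) * prob c j) ⟩
  (e * F) * moment c r
    ≡⟨ solve 3 (λ e F M → (e :* F) :* M := e :* (M :* F)) refl e F (moment c r) ⟩
  e * (moment c r * F)                            ∎
  where
  open ≡-Reasoning
  r = suc n
  e = evalAt1 c
  L = length c
  F = invFact r
  instance _ = ≢-nonZero c1≢0
  term≡ : ∀ j → coeff c j * exp (ι j) r ≡ (e * F) * ((ι j ^ r) * prob c j)
  term≡ j = begin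
    coeff c j * ((ι j ^ r) * F)
      ≡⟨ solve 3 (λ a x f → a :* (x :* f) := con 1ℚ :* (a :* (x :* f))) refl (coeff c j) (ι j ^ r) F ⟩
    1ℚ * (coeff c j * ((ι j ^ r) * F))
      ≡⟨ cong (_* (coeff c j * ((ι j ^ r) * F))) (sym (ℚP.*-inverseʳ e)) ⟩
    (e * (1/ e)) * (coeff c j * ((ι j ^ r) * F))
      ≡⟨ solve 5 (λ e w a x f → (e :* w) :* (a :* (x :* f)) := (e :* f) :* (x :* (a :* w))) refl
           e (1/ e) (coeff c j) (ι j ^ r) F ⟩
    (e * F) * ((ι j ^ r) * (coeff c j * (1/ e)))
      ≡⟨ cong (λ z → (e * F) * ((ι j ^ r) * z)) (sym (÷₀-by-inverse {x = coeff c j} {y = e} (ℚP.*-inverseʳ e))) ⟩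
    (e * F) * ((ι j ^ r) * prob c j) ∎

Log-cumulants : ∀ c → evalAt1 c ≢ 0ℚ → Log (ev c) (cumulantSeries (moment c))
Log-cumulants c c1≢0 = Log-congˡ {κ = cumulantSeries (moment c)} (λ n → sym (ev≡mgf c c1≢0 n))
  (Log-scale {κ = cumulantSeries (moment c)} (evalAt1 c) (Log-mgf (moment c)))

ΣFin-zero : ∀ k (f : Fin k → ℚ) → (∀ i → f i ≡ 0ℚ) → ΣFin k f ≡ 0ℚ
ΣFin-zero zero f _ = refl
ΣFin-zero (suc k) f f≡0 = cong₂ _+_ (f≡0 fzero) (ΣFin-zero k (f ∘ fsuc) (f≡0 ∘ fsuc))

ΣFin-difference : ∀ k x (f g h : Fin k → ℚ) → (∀ i → f i - g i ≡ x * h i)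
                → ΣFin k f - ΣFin k g ≡ x * ΣFin k h
ΣFin-difference zero x f g h _ = sym (ℚP.*-zeroʳ x)
ΣFin-difference (suc k) x f g h f-g≡xh = begin
  (f fzero + ΣFin k (f ∘ fsuc)) - (g fzero + ΣFin k (g ∘ fsuc))
    ≡⟨ solve 4 (λ a b c d → (a :+ b) :- (c :+ d) := (a :- c) :+ (b :- d)) refl
         (f fzero) (ΣFin k (f ∘ fsuc)) (g fzero) (ΣFin k (g ∘ fsuc)) ⟩
  (f fzero - g fzero) + (ΣFin k (f ∘ fsuc) - ΣFin k (g ∘ fsuc))
    ≡⟨ cong₂ _+_ (f-g≡xh fzero) (ΣFin-difference k x (f ∘ fsuc) (g ∘ fsuc) (h ∘ fsuc) (f-g≡xh ∘ fsuc)) ⟩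
  x * h fzero + x * ΣFin k (h ∘ fsuc)  ≡⟨ sym (ℚP.*-distribˡ-+ x (h fzero) (ΣFin k (h ∘ fsuc))) ⟩
  x * (h fzero + ΣFin k (h ∘ fsuc))    ∎
  where open ≡-Reasoning

quotient-at-eᵗ : ∀ k a b c → IsQuotient k a b c → qintProduct k b ⋆ ev c ≗ qintProduct k a
quotient-at-eᵗ k a b c quot n = begin
  (qintProduct k b ⋆ ev c) n   ≡⟨ ⋆-congˡ (ev c) (λ m → sym (ev-∏P k (qint ∘ b) m)) n ⟩
  (ev ∏b ⋆ ev c) n             ≡⟨ ⋆-comm (ev ∏b) (ev c) n ⟩
  (ev c ⋆ ev ∏b) n             ≡⟨ sym (ev-⊛ c ∏b n) ⟩
  ev (c ⊛ ∏b) n                ≡⟨ ev-coeff (c ⊛ ∏b) (∏P k (qint ∘ a)) quot n ⟩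
  ev (∏P k (qint ∘ a)) n       ≡⟨ ev-∏P k (qint ∘ a) n ⟩
  qintProduct k a n            ∎
  where
  open ≡-Reasoning
  ∏b = ∏P k (qint ∘ b)

evalAt1≢0 : ∀ k a b c → (∀ i → 0 < a i) → IsQuotient k a b c → evalAt1 c ≢ 0ℚ
evalAt1≢0 k a b c a>0 quot c1≡0 = qintProduct-at-0≢0 k a a>0 (begin
  qintProduct k a 0                  ≡⟨ sym (quotient-at-eᵗ k a b c quot 0) ⟩
  qintProduct k b 0 * ev c 0         ≡⟨ cong (qintProduct k b 0 *_) (trans (ev-at-0 c) c1≡0) ⟩
  qintProduct k b 0 * 0ℚ             ≡⟨ ℚP.*-zeroʳ (qintProduct k b 0) ⟩
  0ℚ                                 ∎)
  where open ≡-Reasoning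

Log-F : ∀ k a b c → (∀ i → 0 < b i) → IsQuotient k a b c → Log (ev c) (logQintSum k a ⊟ logQintSum k b)
Log-F k a b c b>0 quot = Log-quotient {κf = logQintSum k b} {κh = logQintSum k a}
  (quotient-at-eᵗ k a b c quot) (Log-qintProduct k b) (Log-qintProduct k a) (qintProduct-at-0≢0 k b b>0)

logQintSum-at-0 : ∀ k a → logQintSum k a 0 ≡ 0ℚ
logQintSum-at-0 k a = ΣFin-zero k (λ i → logQint (a i) 0) (λ _ → refl)

logQintSum-coefficient : ∀ k a b r → (logQintSum k a ⊟ logQintSum k b) (suc r)
  ≡ invFact (suc r) * ((bernoulli (suc r) ÷₀ ι (suc r)) * ΣFin k (λ i → (ι (a i) ^ suc r) - (ι (b i) ^ suc r)))
logQintSum-coefficient k a b r = begin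
  logQintSum k a R - logQintSum k b R
    ≡⟨ ΣFin-difference k (β R) _ _ _ (λ i →
         solve 3 (λ x y z → (x :* z :- z) :- (y :* z :- z) := z :* (x :- y)) refl
           (ι (a i) ^ R) (ι (b i) ^ R) (β R)) ⟩
  bernoulli R * invFact R * recip r * H
    ≡⟨ solve 4 (λ B f v h → B :* f :* v :* h := f :* ((B :* v) :* h)) refl (bernoulli R) (invFact R) (recip r) H ⟩
  invFact R * ((bernoulli R * recip r) * H)
    ≡⟨ cong (λ z → invFact R * (z * H)) (sym (÷₀-ι-suc (bernoulli R) r)) ⟩
  invFact R * ((bernoulli R ÷₀ ι R) * H) ∎
  where
  open ≡-Reasoning
  R = suc r
  H = ΣFin k (λ i → (ι (a i) ^ R) - (ι (b i) ^ R))

-- Both K(t) and Σᵢ β(aᵢt) − β(bᵢt) are logarithms of F(e^t) vanishing at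
-- t = 0, so they coincide; compare the coefficients of tʳ.  (The
-- nonnegativity of the coefficients, which makes X a random variable, is
-- not needed for the formal identity.)
lemma7p1 : (k : ℕ) (a b : Fin k → ℕ)
    → (∀ i → 0 < a i) → (∀ i → 0 < b i)
    → (c : Poly) → IsQuotient k a b c
    → (∀ j → 0ℚ ≤ℚ coeff c j)
    → (r : ℕ) → 1 ≤ r
    → cumulant c r
      ≡ (bernoulli r ÷₀ ℕ→ℚ r)
        * ΣFin k (λ i → (ℕ→ℚ (a i) ^ℚ r) - (ℕ→ℚ (b i) ^ℚ r))
lemma7p1 k a b a>0 b>0 c quot _ (suc r) _ = *-cancelˡ-≢0 (invFact≢0 (suc r)) (begin
  invFact (suc r) * cumulant c (suc r)       ≡⟨ ℚP.*-comm (invFact (suc r)) (cumulant c (suc r)) ⟩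
  cumulantSeries (moment c) (suc r)          ≡⟨ K≗Σβ (suc r) ⟩
  (logQintSum k a ⊟ logQintSum k b) (suc r)  ≡⟨ logQintSum-coefficient k a b r ⟩
  invFact (suc r) * ((bernoulli (suc r) ÷₀ ι (suc r)) * ΣFin k (λ i → (ι (a i) ^ suc r) - (ι (b i) ^ suc r))) ∎)
  where
  open ≡-Reasoning
  c1≢0 : evalAt1 c ≢ 0ℚ
  c1≢0 = evalAt1≢0 k a b c a>0 quot
  K≗Σβ : cumulantSeries (moment c) ≗ logQintSum k a ⊟ logQintSum k b
  K≗Σβ = Log-unique (subst (_≢ 0ℚ) (sym (ev-at-0 c)) c1≢0)
    (Log-cumulants c c1≢0) (Log-F k a b c b>0 quot)
    (sym (cong₂ _-_ (logQintSum-at-0 k a) (logQintSum-at-0 k b)))
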